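{- Let $n$, $s$, $k$ be nonnegative integers with $s\le k\le\lfloor\frac{n-1}{2}\rfloor$. For each $t$, let $K_t$ be the number of $s$-element subsets $S\subseteq\{1,\dots,n\}$ that satisfy at least $t$ of the $j$-conditions, $0\le j\le s$. Then for every $0\le l\le s$, $K_{s+1-l}=\binom{n}{l}$.
   Context: Fix $n,s,k$ as in the claim. An $s$-element subset $S\subseteq\{1,\dots,n\}$ (the positions of $s$ "marked boxes" in a row of $n$ boxes) satisfies the $j$-condition, for $0\le j\le s$, if the position $p_j=s+k+1-2j$ is not in $S$ and exactly $s-j$ elements of $S$ are smaller than $p_j$ (so exactly $j$ elements of $S$ are larger than $p_j$). -}

module Defs where

open import Data.Bool using (Bool; true; false; if_then_else_)
open import Data.Nat using (ℕ; zero; suc; _+_; _*_; _∸_; _<ᵇ_; _≡ᵇ_; _≤ᵇ_)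
open import Data.List using (List; []; _∷_; _++_; map; length; upTo)
open import Data.Bool using (_∧_; _∨_)
open import Data.Vec using (Vec; []; _∷_)
open import Data.Fin.Subset using (Subset; ∣_∣)

count : {A : Set} → (A → Bool) → List A → ℕ
count p []       = 0
count p (x ∷ xs) = if p x then suc (count p xs) else count p xs

anyB : {A : Set} → (A → Bool) → List A → Bool
anyB p []       = false
anyB p (x ∷ xs) = p x ∨ anyB p xs

allSubsets : (n : ℕ) → List (Subset n)
allSubsets zero    = [] ∷ []
allSubsets (suc n) = map (false ∷_) (allSubsets n) ++ map (true ∷_) (allSubsets n)

-- Elements of S as positions in {1,…,n}: bit number i (0-based) is position i+1.
elemsFrom : {m : ℕ} → ℕ → Vec Bool m → List ℕ
elemsFrom i []          = []
elemsFrom i (true ∷ v)  = i ∷ elemsFrom (suc i) v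
elemsFrom i (false ∷ v) = elemsFrom (suc i) v

elems : {n : ℕ} → Subset n → List ℕ
elems S = elemsFrom 1 S

pos : (s k j : ℕ) → ℕ
pos s k j = (s + k + 1) ∸ (2 * j)

jCond : {n : ℕ} → (s k : ℕ) → Subset n → ℕ → Bool
jCond s k S j =
  if anyB (λ x → x ≡ᵇ pos s k j) (elems S)
    then false
    else (count (λ x → x <ᵇ pos s k j) (elems S) ≡ᵇ (s ∸ j))

numConds : {n : ℕ} → (s k : ℕ) → Subset n → ℕ
numConds s k S = count (λ j → jCond s k S j) (upTo (suc s))

K : (n s k t : ℕ) → ℕ
K n s k t =
  count (λ S → (∣ S ∣ ≡ᵇ s) ∧ (t ≤ᵇ numConds s k S)) (allSubsets n)

-- Read S ⊆ {1,…,n} as a walk with an up-step at every element and a down-step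
-- elsewhere, at height 2a + r − x just before position x, where a = #(S ∩ [1,x))
-- and r = k − s + 1; it starts at height k − s.  As p_j = 2(s − j) + r, the
-- j-condition says that p_j is a down-step taken from height 0 preceded by
-- exactly s − j elements; conversely a down-step from height 0 preceded by
-- a ≤ s elements is p_{s−a} with its condition satisfied.  Hence the number of
-- satisfied conditions is the number of down-steps taken from height 0.  Since
-- 2k + 1 ≤ n every such walk ends below 0, and then the walks with d up-steps
-- taking at least m + 1 down-steps from 0 number C(n, d − m), by induction on n
-- with Pascal's rule.  With d = s and m = s − l this is C(n, l).

module Submission where

open import Defs
open import Data.Nat using (ℕ; zero; suc; _+_; _*_; _∸_; _≤_; _<_; _≤ᵇ_; _<ᵇ_; _≡ᵇ_; s≤s; z≤n)
open import Data.Nat.Properties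
open import Data.Nat.Combinatorics using (_C_; nCk+nC[k+1]≡[n+1]C[k+1])
open import Data.Nat.Tactic.RingSolver using (solve-∀)
open import Algebra.Properties.CommutativeSemigroup +-commutativeSemigroup
  using () renaming (interchange to +-interchange)
open import Data.Integer.Base as ℤ using (ℤ; +_; -[1+_]; _⊖_)
open import Data.Integer.Properties using ([1+m]⊖[1+n]≡m⊖n; distribʳ-⊖-+-pos; distribʳ-⊖-+-neg)
open import Data.Bool using (Bool; true; false; _∧_; if_then_else_)
open import Data.Bool.Properties using (∧-identityʳ; ∧-zeroʳ; if-eta)
open import Data.List using (List; []; _∷_; _++_; map; upTo; applyUpTo)
open import Data.List.Properties using (map-upTo)
open import Data.List.Relation.Unary.All using (All; []; _∷_; universal)
open import Data.List.Relation.Unary.All.Properties using (applyUpTo⁺₁)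
open import Data.Vec using (Vec; []; _∷_)
open import Data.Fin.Subset using (Subset; ∣_∣)
open import Data.Empty using (⊥-elim)
open import Function using (_∘_)
open import Relation.Nullary using (yes; no; ¬_)
open import Relation.Nullary.Decidable using (dec-true; dec-false)
open import Relation.Binary.PropositionalEquality

toℕ : Bool → ℕ
toℕ b = if b then 1 else 0

≡ᵇ-refl : ∀ m → (m ≡ᵇ m) ≡ true
≡ᵇ-refl m = dec-true (m ≟ m) refl

≢⇒≡ᵇ-false : ∀ {m n} → m ≢ n → (m ≡ᵇ n) ≡ false
≢⇒≡ᵇ-false {m} {n} = dec-false (m ≟ n)

<⇒<ᵇ-true : ∀ {m n} → m < n → (m <ᵇ n) ≡ true
<⇒<ᵇ-true {m} {n} = dec-true (m <? n)

≮⇒<ᵇ-false : ∀ {m n} → ¬ m < n → (m <ᵇ n) ≡ false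
≮⇒<ᵇ-false {m} {n} = dec-false (m <? n)

count-++ : ∀ {A : Set} (p : A → Bool) (xs ys : List A) →
           count p (xs ++ ys) ≡ count p xs + count p ys
count-++ p []       ys = refl
count-++ p (x ∷ xs) ys with p x
... | true  = cong suc (count-++ p xs ys)
... | false = count-++ p xs ys

count-map : ∀ {A B : Set} (p : B → Bool) (f : A → B) (xs : List A) →
            count p (map f xs) ≡ count (λ x → p (f x)) xs
count-map p f []       = refl
count-map p f (x ∷ xs) with p (f x)
... | true  = cong suc (count-map p f xs)
... | false = count-map p f xs

count-cong : ∀ {A : Set} {p q : A → Bool} {xs : List A} →
             All (λ x → p x ≡ q x) xs → count p xs ≡ count q xs
count-cong                  []             = refl
count-cong {p = p} (_∷_ {x} e es) with p x
... | true  rewrite sym e = cong suc (count-cong es)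
... | false rewrite sym e = count-cong es

count-false : ∀ {A : Set} (xs : List A) → count (λ _ → false) xs ≡ 0
count-false []       = refl
count-false (x ∷ xs) = count-false xs

count-∷ : ∀ {A : Set} (p : A → Bool) x xs → count p (x ∷ xs) ≡ toℕ (p x) + count p xs
count-∷ p x xs with p x
... | true  = refl
... | false = refl

count-≡ᵇ-upTo : ∀ {c N} → c < N → count (_≡ᵇ c) (upTo N) ≡ 1
count-≡ᵇ-upTo {zero} {suc N} _ = begin
  suc (count (_≡ᵇ 0) (applyUpTo suc N))  ≡⟨ cong (suc ∘ count (_≡ᵇ 0)) (map-upTo suc N) ⟨
  suc (count (_≡ᵇ 0) (map suc (upTo N))) ≡⟨ cong suc (count-map (_≡ᵇ 0) suc (upTo N)) ⟩
  suc (count (λ _ → false) (upTo N))     ≡⟨ cong suc (count-false (upTo N)) ⟩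
  1 ∎
  where open ≡-Reasoning
count-≡ᵇ-upTo {suc c} {suc N} (s≤s c<N) = begin
  count (_≡ᵇ suc c) (applyUpTo suc N)     ≡⟨ cong (count (_≡ᵇ suc c)) (map-upTo suc N) ⟨
  count (_≡ᵇ suc c) (map suc (upTo N))    ≡⟨ count-map (_≡ᵇ suc c) suc (upTo N) ⟩
  count (_≡ᵇ c) (upTo N)                  ≡⟨ count-≡ᵇ-upTo c<N ⟩
  1 ∎
  where open ≡-Reasoning

∸-swap : ∀ {s b j} → j ≤ s → b ≡ s ∸ j → j ≡ s ∸ b
∸-swap {s} j≤s b≡s∸j = sym (trans (cong (s ∸_) b≡s∸j) (m∸[m∸n]≡n j≤s))

count-∸-upTo : ∀ {b s} → b ≤ s → count (λ j → b ≡ᵇ s ∸ j) (upTo (suc s)) ≡ 1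
count-∸-upTo {b} {s} b≤s =
  trans (count-cong (applyUpTo⁺₁ (λ j → j) (suc s) (λ j<1+s → ≡ᵇ-swap (≤-pred j<1+s))))
        (count-≡ᵇ-upTo (s≤s (m∸n≤m s b)))
  where
  ≡ᵇ-swap : ∀ {j} → j ≤ s → (b ≡ᵇ s ∸ j) ≡ (j ≡ᵇ s ∸ b)
  ≡ᵇ-swap {j} j≤s with b ≟ s ∸ j
  ... | yes e = trans (dec-true (b ≟ s ∸ j) e) (sym (dec-true (j ≟ s ∸ b) (∸-swap j≤s e)))
  ... | no ne = trans (dec-false (b ≟ s ∸ j) ne)
                      (sym (dec-false (j ≟ s ∸ b) (λ e → ne (∸-swap b≤s e))))

count-allSubsets-suc : ∀ n (p : Subset (suc n) → Bool) →
  count p (allSubsets (suc n)) ≡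
  count (λ S → p (false ∷ S)) (allSubsets n) + count (λ S → p (true ∷ S)) (allSubsets n)
count-allSubsets-suc n p = begin
  count p (map (false ∷_) (allSubsets n) ++ map (true ∷_) (allSubsets n))
    ≡⟨ count-++ p (map (false ∷_) (allSubsets n)) (map (true ∷_) (allSubsets n)) ⟩
  count p (map (false ∷_) (allSubsets n)) + count p (map (true ∷_) (allSubsets n))
    ≡⟨ cong₂ _+_ (count-map p (false ∷_) (allSubsets n)) (count-map p (true ∷_) (allSubsets n)) ⟩
  count (λ S → p (false ∷ S)) (allSubsets n) + count (λ S → p (true ∷ S)) (allSubsets n) ∎
  where open ≡-Reasoning

count-subsetsOfSize : ∀ n d → count (λ S → ∣ S ∣ ≡ᵇ d) (allSubsets n) ≡ n C d
count-subsetsOfSize zero    zero    = refl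
count-subsetsOfSize zero    (suc d) = refl
count-subsetsOfSize (suc n) zero    = begin
  count (λ S → ∣ S ∣ ≡ᵇ 0) (allSubsets (suc n))  ≡⟨ count-allSubsets-suc n _ ⟩
  count (λ S → ∣ S ∣ ≡ᵇ 0) (allSubsets n) + count (λ _ → false) (allSubsets n)
    ≡⟨ cong₂ _+_ (count-subsetsOfSize n 0) (count-false (allSubsets n)) ⟩
  n C 0 + 0  ≡⟨⟩
  suc n C 0 ∎
  where open ≡-Reasoning
count-subsetsOfSize (suc n) (suc d) = begin
  count (λ S → ∣ S ∣ ≡ᵇ suc d) (allSubsets (suc n))  ≡⟨ count-allSubsets-suc n _ ⟩
  count (λ S → ∣ S ∣ ≡ᵇ suc d) (allSubsets n) + count (λ S → ∣ S ∣ ≡ᵇ d) (allSubsets n)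
    ≡⟨ cong₂ _+_ (count-subsetsOfSize n (suc d)) (count-subsetsOfSize n d) ⟩
  n C suc d + n C d  ≡⟨ +-comm (n C suc d) (n C d) ⟩
  n C d + n C suc d  ≡⟨ nCk+nC[k+1]≡[n+1]C[k+1] n d ⟩
  suc n C suc d ∎
  where open ≡-Reasoning

infix 6.5 _C[_-_]
_C[_-_] : ℕ → ℕ → ℕ → ℕ
n C[ d     - zero  ] = n C d
n C[ zero  - suc c ] = 0
n C[ suc d - suc c ] = n C[ d - c ]

C[-]-pascal : ∀ n d c → suc n C[ d - c ] ≡ n C[ d - suc c ] + n C[ d - c ]
C[-]-pascal n zero    zero    = refl
C[-]-pascal n (suc d) zero    = sym (nCk+nC[k+1]≡[n+1]C[k+1] n d)
C[-]-pascal n zero    (suc c) = refl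
C[-]-pascal n (suc d) (suc c) = C[-]-pascal n d c

C[-]-≤ : ∀ n {d c} → c ≤ d → n C[ d - c ] ≡ n C (d ∸ c)
C[-]-≤ n {c = zero}      _         = refl
C[-]-≤ n {suc d} {suc c} (s≤s c≤d) = C[-]-≤ n c≤d

C[-]-< : ∀ n {d c} → d < c → n C[ d - c ] ≡ 0
C[-]-< n {zero}  {suc c} _         = refl
C[-]-< n {suc d} {suc c} (s≤s d<c) = C[-]-< n d<c

isZero : ℤ → ℕ
isZero (+ zero)  = 1
isZero (+ suc _) = 0
isZero -[1+ _ ]  = 0

downsAt0 : ∀ {m} → ℤ → Vec Bool m → ℕ
downsAt0 h []          = 0
downsAt0 h (true ∷ v)  = downsAt0 (ℤ.suc h) v
downsAt0 h (false ∷ v) = isZero h + downsAt0 (ℤ.pred h) v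

walks : ℕ → ℕ → ℤ → ℕ → ℕ
walks n d h m = count (λ S → (∣ S ∣ ≡ᵇ d) ∧ (m ≤ᵇ downsAt0 h S)) (allSubsets n)

walksDownFirst : ℕ → ℕ → ℤ → ℕ → ℕ
walksDownFirst n d h m =
  count (λ S → (∣ S ∣ ≡ᵇ d) ∧ (m ≤ᵇ isZero h + downsAt0 (ℤ.pred h) S)) (allSubsets n)

walksUpFirst : ℕ → ℕ → ℤ → ℕ → ℕ
walksUpFirst n d h m =
  count (λ S → (suc ∣ S ∣ ≡ᵇ d) ∧ (m ≤ᵇ downsAt0 (ℤ.suc h) S)) (allSubsets n)

walks-suc : ∀ n d h m → walks (suc n) d h m ≡ walksDownFirst n d h m + walksUpFirst n d h m
walks-suc n d h m = count-allSubsets-suc n _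

walks-zero : ∀ n d h → walks n d h 0 ≡ n C d
walks-zero n d h =
  trans (count-cong (universal (λ S → ∧-identityʳ (∣ S ∣ ≡ᵇ d)) (allSubsets n)))
        (count-subsetsOfSize n d)

walks-empty : ∀ d h m → walks 0 d h (suc m) ≡ 0
walks-empty d h m = cong toℕ (∧-zeroʳ (0 ≡ᵇ d))

-- h + d − (n − d) < 0: the walks of n steps with d up-steps from h end below 0.
EndsBelowZero : ℕ → ℕ → ℤ → Set
EndsBelowZero n d (+ p)    = suc (p + d + d) ≤ n
EndsBelowZero n d -[1+ e ] = d + d ≤ n + e

endsBelowZero-pred : ∀ {n} d h → EndsBelowZero (suc n) d h → EndsBelowZero n d (ℤ.pred h)
endsBelowZero-pred {n} d (+ zero)  (s≤s b) = subst (d + d ≤_) (sym (+-identityʳ n)) b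
endsBelowZero-pred     d (+ suc p) (s≤s b) = b
endsBelowZero-pred {n} d -[1+ e ]  b       = subst (d + d ≤_) (sym (+-suc n e)) b

endsBelowZero-suc : ∀ {n} d h → EndsBelowZero (suc n) (suc d) h → EndsBelowZero n d (ℤ.suc h)
endsBelowZero-suc     d (+ p) b
  rewrite +-suc p d | +-suc (p + d) d = ≤-pred b
endsBelowZero-suc {n} d -[1+ zero ] b
  rewrite +-suc d d | +-identityʳ n = ≤-pred b
endsBelowZero-suc {n} d -[1+ suc e ] b
  rewrite +-suc d d | +-suc n e = ≤-pred (≤-pred b)

depth : ℤ → ℕ
depth (+ _)    = 0
depth -[1+ e ] = suc e

depth-suc-neg : ∀ e → depth (ℤ.suc -[1+ e ]) ≡ e
depth-suc-neg zero    = refl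
depth-suc-neg (suc e) = refl

walks-endsBelowZero : ∀ n d h m → EndsBelowZero n d h →
                      walks n d h (suc m) ≡ n C[ d - depth h + m ]
walksUpFirst-endsBelowZero : ∀ n d h m → EndsBelowZero (suc n) d h →
                      walksUpFirst n d h (suc m) ≡ n C[ d - suc (depth (ℤ.suc h) + m) ]

walks-endsBelowZero zero d (+ p) m ()
walks-endsBelowZero zero d -[1+ e ] m b =
  trans (walks-empty d -[1+ e ] m)
        (sym (C[-]-< 0 (s≤s (≤-trans (m≤m+n d d) (≤-trans b (m≤m+n e m))))))
walks-endsBelowZero (suc n) d (+ p) m b = begin
  walks (suc n) d (+ p) (suc m)
    ≡⟨ walks-suc n d (+ p) (suc m) ⟩
  walksDownFirst n d (+ p) (suc m) + walksUpFirst n d (+ p) (suc m)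
    ≡⟨ cong₂ _+_ (walksDownFirst-nonneg p m b) (walksUpFirst-endsBelowZero n d (+ p) m b) ⟩
  n C[ d - m ] + n C[ d - suc m ]  ≡⟨ +-comm (n C[ d - m ]) _ ⟩
  n C[ d - suc m ] + n C[ d - m ]  ≡⟨ C[-]-pascal n d m ⟨
  suc n C[ d - m ] ∎
  where
  open ≡-Reasoning
  walksDownFirst-nonneg : ∀ p m → EndsBelowZero (suc n) d (+ p) →
                          walksDownFirst n d (+ p) (suc m) ≡ n C[ d - m ]
  walksDownFirst-nonneg zero    zero    _ = walks-zero n d -[1+ 0 ]
  walksDownFirst-nonneg zero    (suc m) b =
    walks-endsBelowZero n d -[1+ 0 ] m (endsBelowZero-pred d (+ 0) b)
  walksDownFirst-nonneg (suc p) m       b =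
    walks-endsBelowZero n d (+ p) m (endsBelowZero-pred d (+ suc p) b)
walks-endsBelowZero (suc n) d -[1+ e ] m b = begin
  walks (suc n) d -[1+ e ] (suc m)
    ≡⟨ walks-suc n d -[1+ e ] (suc m) ⟩
  walksDownFirst n d -[1+ e ] (suc m) + walksUpFirst n d -[1+ e ] (suc m)
    ≡⟨ cong₂ _+_ (walks-endsBelowZero n d -[1+ suc e ] m (endsBelowZero-pred d -[1+ e ] b))
                 (walksUpFirst-endsBelowZero n d -[1+ e ] m b) ⟩
  n C[ d - suc (suc e + m) ] + n C[ d - suc (depth (ℤ.suc -[1+ e ]) + m) ]
    ≡⟨ cong (λ c → n C[ d - suc (suc e + m) ] + n C[ d - suc (c + m) ]) (depth-suc-neg e) ⟩
  n C[ d - suc (suc e + m) ] + n C[ d - suc e + m ]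
    ≡⟨ C[-]-pascal n d (suc e + m) ⟨
  suc n C[ d - suc e + m ] ∎
  where open ≡-Reasoning

walksUpFirst-endsBelowZero n zero    h m _ = count-false (allSubsets n)
walksUpFirst-endsBelowZero n (suc d) h m b =
  walks-endsBelowZero n d (ℤ.suc h) m (endsBelowZero-suc d h b)

isZero-⊖ : ∀ u x → isZero (u ⊖ x) ≡ toℕ (x ≡ᵇ u)
isZero-⊖ zero    zero    = refl
isZero-⊖ (suc u) zero    = refl
isZero-⊖ zero    (suc x) = refl
isZero-⊖ (suc u) (suc x) = trans (cong isZero ([1+m]⊖[1+n]≡m⊖n u x)) (isZero-⊖ u x)

-- jCond s k S j is isGapOfRank (pos s k j) (s ∸ j) 1 0 S; in general the scan of
-- the tail v of S starts at position x, after a elements of S.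
isGapOfRank : ∀ {m} → ℕ → ℕ → ℕ → ℕ → Vec Bool m → Bool
isGapOfRank q i x a v =
  if anyB (_≡ᵇ q) (elemsFrom x v) then false
  else (a + count (_<ᵇ q) (elemsFrom x v) ≡ᵇ i)

isGapOfRank-past : ∀ {m q} i y a (v : Vec Bool m) → q < y → isGapOfRank q i y a v ≡ (a ≡ᵇ i)
isGapOfRank-past i y a []          _   = cong (_≡ᵇ i) (+-identityʳ a)
isGapOfRank-past i y a (false ∷ v) q<y = isGapOfRank-past i (suc y) a v (m<n⇒m<1+n q<y)
isGapOfRank-past i y a (true ∷ v)  q<y
  rewrite ≢⇒≡ᵇ-false (>⇒≢ q<y) | ≮⇒<ᵇ-false (<⇒≯ q<y) =
  isGapOfRank-past i (suc y) a v (m<n⇒m<1+n q<y)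

isGapOfRank-member : ∀ {m} q i a (v : Vec Bool m) → isGapOfRank q i q a (true ∷ v) ≡ false
isGapOfRank-member q i a v rewrite ≡ᵇ-refl q = refl

isGapOfRank-before : ∀ {m q} i x a (v : Vec Bool m) → x < q →
  isGapOfRank q i x a (true ∷ v) ≡ isGapOfRank q i (suc x) (suc a) v
isGapOfRank-before {q = q} i x a v x<q
  rewrite ≢⇒≡ᵇ-false (<⇒≢ x<q) | <⇒<ᵇ-true x<q
        | +-suc a (count (_<ᵇ q) (elemsFrom (suc x) v)) = refl

-- Scanning S from position x, after a of its elements: a hit is a position x ∉ S
-- with x = 2a + r, and it contributes g a.
hitWeight : ∀ {m} → ℕ → (ℕ → ℕ) → ℕ → ℕ → Vec Bool m → ℕ
hitWeight r g x a []          = 0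
hitWeight r g x a (true ∷ v)  = hitWeight r g (suc x) (suc a) v
hitWeight r g x a (false ∷ v) = (if x ≡ᵇ 2 * a + r then g a else 0) + hitWeight r g (suc x) a v

module _ (r : ℕ) where

  hitWeight-zero : ∀ {m} x a (v : Vec Bool m) → hitWeight r (λ _ → 0) x a v ≡ 0
  hitWeight-zero x a []          = refl
  hitWeight-zero x a (true ∷ v)  = hitWeight-zero (suc x) (suc a) v
  hitWeight-zero x a (false ∷ v) =
    trans (cong (_+ hitWeight r (λ _ → 0) (suc x) a v) (if-eta (x ≡ᵇ 2 * a + r)))
          (hitWeight-zero (suc x) a v)

  hitWeight-+ : ∀ {m} (g h : ℕ → ℕ) x a (v : Vec Bool m) →
    hitWeight r (λ b → g b + h b) x a v ≡ hitWeight r g x a v + hitWeight r h x a v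
  hitWeight-+ g h x a []          = refl
  hitWeight-+ g h x a (true ∷ v)  = hitWeight-+ g h (suc x) (suc a) v
  hitWeight-+ g h x a (false ∷ v) with x ≡ᵇ 2 * a + r
  ... | true  = trans (cong (_+_ (g a + h a)) (hitWeight-+ g h (suc x) a v))
                      (+-interchange (g a) (h a) _ _)
  ... | false = hitWeight-+ g h (suc x) a v

  hitWeight-cong : ∀ {m} {g h : ℕ → ℕ} B → (∀ b → b ≤ B → g b ≡ h b) →
    ∀ x a (v : Vec Bool m) → a + ∣ v ∣ ≤ B → hitWeight r g x a v ≡ hitWeight r h x a v
  hitWeight-cong B g≗h x a []          _ = refl
  hitWeight-cong B g≗h x a (true ∷ v)  a+∣v∣≤B =
    hitWeight-cong B g≗h (suc x) (suc a) v (subst (_≤ B) (+-suc a ∣ v ∣) a+∣v∣≤B)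
  hitWeight-cong B g≗h x a (false ∷ v) a+∣v∣≤B =
    cong₂ (λ w rest → (if x ≡ᵇ 2 * a + r then w else 0) + rest)
          (g≗h a (≤-trans (m≤m+n a ∣ v ∣) a+∣v∣≤B))
          (hitWeight-cong B g≗h (suc x) a v a+∣v∣≤B)

  hitWeight-count : ∀ {m} (p : ℕ → Bool) (w : ℕ → ℕ → Bool) x a (v : Vec Bool m) js →
    All (λ j → toℕ (p j) ≡ hitWeight r (λ b → toℕ (w j b)) x a v) js →
    count p js ≡ hitWeight r (λ b → count (λ j → w j b) js) x a v
  hitWeight-count p w x a v []       []       = sym (hitWeight-zero x a v)
  hitWeight-count p w x a v (j ∷ js) (e ∷ es) = begin
    count p (j ∷ js)                ≡⟨ count-∷ p j js ⟩
    toℕ (p j) + count p js          ≡⟨ cong₂ _+_ e (hitWeight-count p w x a v js es) ⟩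
    hitWeight r (λ b → toℕ (w j b)) x a v + hitWeight r (λ b → count (λ j → w j b) js) x a v
      ≡⟨ hitWeight-+ _ _ x a v ⟨
    hitWeight r (λ b → toℕ (w j b) + count (λ j → w j b) js) x a v
      ≡⟨ hitWeight-cong (a + ∣ v ∣) (λ b _ → sym (count-∷ (λ j → w j b) j js)) x a v ≤-refl ⟩
    hitWeight r (λ b → count (λ j → w j b) (j ∷ js)) x a v ∎
    where open ≡-Reasoning

  hitTerm-off : ∀ {x i} a → x ≢ 2 * i + r → (if x ≡ᵇ 2 * a + r then toℕ (a ≡ᵇ i) else 0) ≡ 0
  hitTerm-off {x} {i} a x≢q with a ≟ i
  ... | yes refl rewrite ≢⇒≡ᵇ-false x≢q = refl
  ... | no  a≢i  rewrite ≢⇒≡ᵇ-false a≢i = if-eta (x ≡ᵇ 2 * a + r)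

  hitTerm-on : ∀ i a → (if 2 * i + r ≡ᵇ 2 * a + r then toℕ (a ≡ᵇ i) else 0) ≡ toℕ (a ≡ᵇ i)
  hitTerm-on i a with a ≟ i
  ... | yes refl rewrite ≡ᵇ-refl (2 * a + r) = refl
  ... | no  a≢i  rewrite ≢⇒≡ᵇ-false a≢i = if-eta (2 * i + r ≡ᵇ 2 * a + r)

  hitWeight-past : ∀ {m} i x a (v : Vec Bool m) → 2 * i + r < x →
                   hitWeight r (λ b → toℕ (b ≡ᵇ i)) x a v ≡ 0
  hitWeight-past i x a []          _   = refl
  hitWeight-past i x a (true ∷ v)  q<x = hitWeight-past i (suc x) (suc a) v (m<n⇒m<1+n q<x)
  hitWeight-past i x a (false ∷ v) q<x =
    cong₂ _+_ (hitTerm-off a (>⇒≢ q<x)) (hitWeight-past i (suc x) a v (m<n⇒m<1+n q<x))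

  isGapOfRank-hitWeight : ∀ {m} i x a (v : Vec Bool m) → x ≤ 2 * i + r → 2 * i + r < x + m →
    toℕ (isGapOfRank (2 * i + r) i x a v) ≡ hitWeight r (λ b → toℕ (b ≡ᵇ i)) x a v
  isGapOfRank-hitWeight i x a [] x≤q q<x+0 =
    ⊥-elim (<⇒≱ (subst (2 * i + r <_) (+-identityʳ x) q<x+0) x≤q)
  isGapOfRank-hitWeight {suc m} i x a (true ∷ v) x≤q q<x+m with x ≟ 2 * i + r
  ... | yes refl rewrite isGapOfRank-member x i a v =
    sym (hitWeight-past i (suc x) (suc a) v (n<1+n x))
  ... | no  x≢q  =
    trans (cong toℕ (isGapOfRank-before i x a v (≤∧≢⇒< x≤q x≢q)))
          (isGapOfRank-hitWeight i (suc x) (suc a) v (≤∧≢⇒< x≤q x≢q)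
                                 (subst (2 * i + r <_) (+-suc x m) q<x+m))
  isGapOfRank-hitWeight {suc m} i x a (false ∷ v) x≤q q<x+m with x ≟ 2 * i + r
  ... | yes refl
    rewrite isGapOfRank-past i (suc x) a v (n<1+n x) | hitWeight-past i (suc x) a v (n<1+n x) =
    sym (trans (+-identityʳ _) (hitTerm-on i a))
  ... | no  x≢q  =
    cong₂ _+_ (sym (hitTerm-off a x≢q))
              (isGapOfRank-hitWeight i (suc x) a v (≤∧≢⇒< x≤q x≢q)
                                     (subst (2 * i + r <_) (+-suc x m) q<x+m))

  hitWeight-downsAt0 : ∀ {m} x a (v : Vec Bool m) →
                       hitWeight r (λ _ → 1) x a v ≡ downsAt0 ((2 * a + r) ⊖ x) v
  hitWeight-downsAt0 x a []          = refl
  hitWeight-downsAt0 x a (true ∷ v)  =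
    trans (hitWeight-downsAt0 (suc x) (suc a) v) (cong (λ h → downsAt0 h v) up-step)
    where
    open ≡-Reasoning
    up-step : (2 * suc a + r) ⊖ suc x ≡ ℤ.suc ((2 * a + r) ⊖ x)
    up-step = begin
      (2 * suc a + r) ⊖ suc x       ≡⟨ cong (λ u → (u + r) ⊖ suc x) (*-suc 2 a) ⟩
      suc (suc (2 * a + r)) ⊖ suc x ≡⟨ [1+m]⊖[1+n]≡m⊖n (suc (2 * a + r)) x ⟩
      suc (2 * a + r) ⊖ x           ≡⟨ distribʳ-⊖-+-pos 1 (2 * a + r) x ⟨
      ℤ.suc ((2 * a + r) ⊖ x)       ∎
  hitWeight-downsAt0 x a (false ∷ v) =
    cong₂ _+_ (sym (isZero-⊖ (2 * a + r) x))
              (trans (hitWeight-downsAt0 (suc x) a v)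
                     (cong (λ h → downsAt0 h v) (sym (distribʳ-⊖-+-neg 0 (2 * a + r) x))))

pos-≡ : ∀ j w u {s k} → j + w ≡ s → s + u ≡ k → pos s k j ≡ 2 * w + suc u
pos-≡ j w u refl refl =
  trans (cong (_∸ 2 * j) (rearrange j w u)) (m+n∸m≡n (2 * j) (2 * w + suc u))
  where
  rearrange : ∀ j w u → j + w + (j + w + u) + 1 ≡ 2 * j + (2 * w + suc u)
  rearrange = solve-∀

module _ {n s k : ℕ} (s≤k : s ≤ k) (2k+1≤n : 2 * k + 1 ≤ n) where

  private
    r : ℕ
    r = suc (k ∸ s)

  jCond-hitWeight : (S : Subset n) → ∀ {j} → j ≤ s →
                    toℕ (jCond s k S j) ≡ hitWeight r (λ b → toℕ (b ≡ᵇ s ∸ j)) 1 0 S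
  jCond-hitWeight S {j} j≤s =
    trans (cong (λ q → toℕ (isGapOfRank q (s ∸ j) 1 0 S)) p≡)
          (isGapOfRank-hitWeight r (s ∸ j) 1 0 S (≤-trans (s≤s z≤n) (m≤n+m r _))
                                 (subst (_< 1 + n) p≡ p<1+n))
    where
    open ≤-Reasoning
    p≡ : pos s k j ≡ 2 * (s ∸ j) + r
    p≡ = pos-≡ j (s ∸ j) (k ∸ s) (m+[n∸m]≡n j≤s) (m+[n∸m]≡n s≤k)
    p<1+n : pos s k j < 1 + n
    p<1+n = s≤s (begin
      pos s k j     ≤⟨ m∸n≤m (s + k + 1) (2 * j) ⟩
      s + k + 1     ≤⟨ +-monoˡ-≤ 1 (+-monoˡ-≤ k s≤k) ⟩
      k + k + 1     ≡⟨ cong (λ z → k + z + 1) (+-identityʳ k) ⟨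
      2 * k + 1     ≤⟨ 2k+1≤n ⟩
      n             ∎)

  numConds-downsAt0 : (S : Subset n) → ∣ S ∣ ≡ s → numConds s k S ≡ downsAt0 (+ (k ∸ s)) S
  numConds-downsAt0 S ∣S∣≡s = begin
    numConds s k S
      ≡⟨ hitWeight-count r (jCond s k S) (λ j b → b ≡ᵇ s ∸ j) 1 0 S (upTo (suc s))
           (applyUpTo⁺₁ (λ j → j) (suc s) (λ j<1+s → jCond-hitWeight S (≤-pred j<1+s))) ⟩
    hitWeight r (λ b → count (λ j → b ≡ᵇ s ∸ j) (upTo (suc s))) 1 0 S
      ≡⟨ hitWeight-cong r s (λ b → count-∸-upTo) 1 0 S (≤-reflexive ∣S∣≡s) ⟩
    hitWeight r (λ _ → 1) 1 0 S
      ≡⟨ hitWeight-downsAt0 r 1 0 S ⟩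
    downsAt0 (+ (k ∸ s)) S ∎
    where open ≡-Reasoning

  K≡walks : ∀ t → K n s k t ≡ walks n s (+ (k ∸ s)) t
  K≡walks t = count-cong (universal sameTest (allSubsets n))
    where
    sameTest : ∀ S → ((∣ S ∣ ≡ᵇ s) ∧ (t ≤ᵇ numConds s k S))
                   ≡ ((∣ S ∣ ≡ᵇ s) ∧ (t ≤ᵇ downsAt0 (+ (k ∸ s)) S))
    sameTest S with ∣ S ∣ ≟ s
    ... | yes ∣S∣≡s = cong (λ c → (∣ S ∣ ≡ᵇ s) ∧ (t ≤ᵇ c)) (numConds-downsAt0 S ∣S∣≡s)
    ... | no  ∣S∣≢s rewrite ≢⇒≡ᵇ-false ∣S∣≢s = refl

  endsBelowZero-start : EndsBelowZero n s (+ (k ∸ s))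
  endsBelowZero-start = begin
    suc (k ∸ s + s + s) ≡⟨ cong (λ z → suc (z + s)) (m∸n+n≡m s≤k) ⟩
    suc (k + s)         ≤⟨ s≤s (+-monoʳ-≤ k s≤k) ⟩
    suc (k + k)         ≡⟨ cong (λ z → suc (k + z)) (+-identityʳ k) ⟨
    suc (2 * k)         ≡⟨ +-comm 1 (2 * k) ⟩
    2 * k + 1           ≤⟨ 2k+1≤n ⟩
    n                   ∎
    where open ≤-Reasoning

theorem5p9 : (n s k : ℕ) → s ≤ k → 2 * k + 1 ≤ n →
             (l : ℕ) → l ≤ s → K n s k (s + 1 ∸ l) ≡ n C l
theorem5p9 n s k s≤k 2k+1≤n l l≤s = begin
  K n s k (s + 1 ∸ l)               ≡⟨ cong (K n s k) (trans (+-∸-comm 1 l≤s) (+-comm (s ∸ l) 1)) ⟩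
  K n s k (suc (s ∸ l))             ≡⟨ K≡walks s≤k 2k+1≤n (suc (s ∸ l)) ⟩
  walks n s (+ (k ∸ s)) (suc (s ∸ l))
    ≡⟨ walks-endsBelowZero n s (+ (k ∸ s)) (s ∸ l) (endsBelowZero-start s≤k 2k+1≤n) ⟩
  n C[ s - s ∸ l ]                  ≡⟨ C[-]-≤ n (m∸n≤m s l) ⟩
  n C (s ∸ (s ∸ l))                 ≡⟨ cong (n C_) (m∸[m∸n]≡n l≤s) ⟩
  n C l                             ∎
  where open ≡-Reasoning
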